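{- (1) If a generalized infinite composition $\tilde\alpha$ reaches level $e$, then $G_{\tilde\alpha}\in\mathcal{J}^{(e)}$. (2) Conversely, let $\tilde\alpha=\tilde\gamma\,0\,a\,\beta\,0\,0\cdots$ be non-standard, factored as in the recursive definition of $G_{\tilde\alpha}$ (with $a>0$, $\beta$ a possibly empty standard composition, $\tilde\gamma$ a possibly empty generalized composition). If $\tilde\gamma\,(a-1)\,\beta\,0\,0\cdots$ reaches level $e$, then $\tilde\alpha$ reaches level $e$.
   Context: A composition $\alpha=[\alpha_1,\ldots,\alpha_k]$ of $d$ is an ordered list of positive integers summing to $d$, with $\ell(\alpha)=k$ and $D(\alpha)=\{\alpha_1,\alpha_1+\alpha_2,\ldots,\alpha_1+\cdots+\alpha_{k-1}\}\subseteq\{1,\ldots,d-1\}$. The fundamental quasi-symmetric function is $F_\alpha(x_1,x_2,\ldots)=\sum x_{j_1}x_{j_2}\cdots x_{j_d}$, summed over $j_1\le j_2\le\cdots\le j_d$ with $j_i<j_{i+1}$ whenever $i\in D(\alpha)$; $F$ of the empty composition is $1$. A generalized infinite composition $\tilde\alpha=(\tilde\alpha_1,\tilde\alpha_2,\ldots)$ has parts $\tilde\alpha_j\ge0$ with $d(\tilde\alpha)=\sum\tilde\alpha_j<\infty$; finite-length generalized compositions are defined similarly, $\ell(\cdot)$ denotes number of parts, juxtaposition denotes concatenation, and a composition is standard if it has no zero parts. A generalized composition $\tilde\alpha$ reaches level $e$ if there is a factorization $\tilde\alpha=\tilde\pi\tilde\rho$ (with $\tilde\pi$ finite) such that $d(\tilde\pi)-\ell(\tilde\pi)\ge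 e$. For $e\ge0$, $\mathcal{J}^{(e)}$ is the ideal of $\mathbb{Q}[[x_1,x_2,\ldots]]$ generated by the $F_\alpha(x_1,x_2,\ldots)$ for standard compositions $\alpha$ having a factorization $\alpha=\pi\rho$ with $d(\pi)-\ell(\pi)\ge e$. The series $G_{\tilde\alpha}$ are defined recursively: write $\tilde\alpha=\tilde\nu\,0\,0\cdots$ with $\tilde\nu$ finite whose last part is non-zero (or $\tilde\nu$ empty), and recurse on $\ell(\tilde\nu)$. If $\tilde\nu=\nu$ is standard, $G_{\tilde\alpha}=F_\nu(x_1,x_2,\ldots)$ (so $G_{0\,0\cdots}=1$). Otherwise write uniquely $\tilde\nu=\tilde\gamma\,0\,a\,\beta$ with $a>0$, $\beta$ a possibly empty standard composition, $\tilde\gamma$ a possibly empty generalized composition; with $k=\ell(\tilde\gamma)+1$ set $G_{\tilde\alpha}=G_{\tilde\gamma\,a\,\beta\,0\cdots}-x_k\,G_{\tilde\gamma\,(a-1)\,\beta\,0\cdots}$. -}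

module Defs where

open import Data.Nat using (ℕ; zero; suc; _+_; _∸_; _≤_; _<_; _<ᵇ_; _≡ᵇ_)
open import Data.Bool using (Bool; true; false; if_then_else_; _∧_)
open import Data.List using (List; []; _∷_; _++_; replicate; length; concatMap; map; upTo; drop)
open import Data.Nat.ListAction using (sum)
open import Data.List.Relation.Unary.All using (All)
open import Data.Product using (_×_; _,_; ∃-syntax)
open import Data.Maybe using (Maybe; just; nothing)
open import Data.Rational using (ℚ; 0ℚ; 1ℚ) renaming (_+_ to _+ℚ_; _*_ to _*ℚ_; -_ to -ℚ_)
open import Relation.Binary.PropositionalEquality using (_≡_)

-- A generalized infinite composition  α̃ = (α̃₁, α̃₂, …)  with
-- finite sum is represented by a finite list  α  standing for
-- α 0 0 0 ⋯ (trailing zeros are implicit).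

Standard : List ℕ → Set
Standard = All (λ a → 1 ≤ a)

trim : List ℕ → List ℕ
trim [] = []
trim (x ∷ xs) with trim xs
... | []     = if x ≡ᵇ 0 then [] else x ∷ []
... | y ∷ ys = x ∷ y ∷ ys

-- D(α) = {α₁, α₁+α₂, …, α₁+⋯+α_{k-1}}
descentsFrom : ℕ → List ℕ → List ℕ
descentsFrom acc []           = []
descentsFrom acc (a ∷ [])     = []
descentsFrom acc (a ∷ b ∷ r)  = (acc + a) ∷ descentsFrom (acc + a) (b ∷ r)

D : List ℕ → List ℕ
D = descentsFrom 0

-- A monomial x₁^{m₀} x₂^{m₁} ⋯ is an exponent list m (index i ↦ exponent
-- of x_{i+1}); lists differing by trailing zeros denote the same monomial.
-- A series is a coefficient function; it is only ever consulted at
-- trimmed exponent lists, so values at non-trimmed lists are irrelevant.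

Series : Set
Series = List ℕ → ℚ

infix 4 _≈_
_≈_ : Series → Series → Set
f ≈ g = ∀ m → f (trim m) ≡ g (trim m)

0S : Series
0S _ = 0ℚ

infixl 6 _⊕_ _⊖_
infixl 7 _⊛_

_⊕_ : Series → Series → Series
(f ⊕ g) m = f m +ℚ g m

_⊖_ : Series → Series → Series
(f ⊖ g) m = f m +ℚ (-ℚ (g m))

splitsℕ : ℕ → List (ℕ × ℕ)
splitsℕ n = map (λ i → i , n ∸ i) (upTo (suc n))

splits : List ℕ → List (List ℕ × List ℕ)
splits [] = ([] , []) ∷ []
splits (n ∷ m) =
  concatMap (λ { (i , j) → map (λ { (p , q) → (i ∷ p) , (j ∷ q) }) (splits m) })
            (splitsℕ n)

sumℚ : List ℚ → ℚ
sumℚ [] = 0ℚ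
sumℚ (q ∷ qs) = q +ℚ sumℚ qs

_⊛_ : Series → Series → Series
(f ⊛ g) m = sumℚ (map (λ { (p , q) → f (trim p) *ℚ g (trim q) }) (splits m))

eqList : List ℕ → List ℕ → Bool
eqList [] [] = true
eqList (x ∷ xs) (y ∷ ys) = (x ≡ᵇ y) ∧ eqList xs ys
eqList _ _ = false

-- var i is the variable x_{i+1}
var : ℕ → Series
var i m = if eqList (trim m) (replicate i 0 ++ (1 ∷ [])) then 1ℚ else 0ℚ

-- The coefficient of x^m in F_α is the number of sequences
-- j₁ ≤ ⋯ ≤ j_d (strict at positions in D(α)) with x_{j₁}⋯x_{j_d} = x^m.
-- The only weakly increasing sequence with content m is word m
-- (value i repeated m_i times, values 0-indexed), so the coefficient is
-- 1 if word m has length d and is strict at every i ∈ D(α), else 0.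

wordFrom : ℕ → List ℕ → List ℕ
wordFrom i [] = []
wordFrom i (k ∷ m) = replicate k i ++ wordFrom (suc i) m

-- j_i < j_{i+1} (1-indexed positions i, i+1)
strictAt : List ℕ → ℕ → Bool
strictAt w i with drop (i ∸ 1) w
... | u ∷ v ∷ _ = u <ᵇ v
... | _         = false

allᵇ : (ℕ → Bool) → List ℕ → Bool
allᵇ p [] = true
allᵇ p (x ∷ xs) = p x ∧ allᵇ p xs

F : List ℕ → Series
F α m = if (sum m ≡ᵇ sum α) ∧ allᵇ (strictAt (wordFrom 0 m)) (D α) then 1ℚ else 0ℚ

-- For a trimmed ν: if ν is not standard, return (γ̃ , a , β) with
-- ν = γ̃ 0 a β, a > 0, β standard (split at the last zero).
splitLastZero : List ℕ → Maybe (List ℕ × ℕ × List ℕ)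
splitLastZero [] = nothing
splitLastZero (x ∷ xs) with splitLastZero xs
... | just (γ , a , β) = just (x ∷ γ , a , β)
... | nothing with x ≡ᵇ 0 | xs
...   | true  | a ∷ β = just ([] , a , β)
...   | _     | _     = nothing

-- fuel-bounded recursion on ℓ(ν̃); fuel = ℓ(ν̃) always suffices
Gfuel : ℕ → List ℕ → Series
Gfuel fuel ν with splitLastZero ν
... | nothing = F ν
... | just (γ , a , β) with fuel
...   | zero  = F ν
...   | suc n = Gfuel n (trim (γ ++ a ∷ β))
                ⊖ var (length γ) ⊛ Gfuel n (trim (γ ++ (a ∸ 1) ∷ β))

-- G_α̃ for α̃ = α 0 0 ⋯ ; with ν̃ = trim α and k = ℓ(γ̃)+1, x_k = var (length γ̃)
G : List ℕ → Series
G α = Gfuel (length (trim α)) (trim α)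

-- α̃ = α 0 0 ⋯ reaches level e: α̃ = π̃ ρ̃ with π̃ finite and
-- d(π̃) - ℓ(π̃) ≥ e.  (Any finite prefix of α 0 0 ⋯ is a prefix of α 0ⁿ.)
ReachesLevel : ℕ → List ℕ → Set
ReachesLevel e α =
  ∃[ π ] ∃[ ρ ] ∃[ n ] ((π ++ ρ ≡ α ++ replicate n 0) × (e + length π ≤ sum π))

GenJ : ℕ → List ℕ → Set
GenJ e α = Standard α × (∃[ π ] ∃[ ρ ] ((π ++ ρ ≡ α) × (e + length π ≤ sum π)))

data InJ (e : ℕ) : Series → Set where
  gen  : ∀ α → GenJ e α → InJ e (F α)
  zer  : InJ e 0S
  add  : ∀ {f g} → InJ e f → InJ e g → InJ e (f ⊕ g)
  mul  : ∀ {f} (r : Series) → InJ e f → InJ e (r ⊛ f)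
  resp : ∀ {f g} → f ≈ g → InJ e f → InJ e g

-- A part of size zero lowers d − ℓ of every prefix containing it, so zero parts (in particular
-- trailing zeros) can be deleted without losing the level reached.  Replacing consecutive parts
-- 0, a by a − 1 (or conversely, when a > 0) leaves d − ℓ unchanged for every prefix containing
-- both, and the only other prefix involved, the one ending at the 0, has smaller d − ℓ than the
-- prefix before it.
-- Hence both terms of G = G_{γ a β} − x_k G_{γ (a−1) β} come from compositions reaching level e,
-- and by induction on the length G is an ideal combination of series F_ν with ν standard and
-- reaching level e, which are generators of J^(e).

module Submission where

open import Defs
open import Data.Nat using (ℕ; zero; suc; _+_; _∸_; _≤_; _<_; s≤s; z≤n; s≤s⁻¹)
open import Data.Nat.Properties using (≤-refl; ≤-trans; n<1+n; +-monoˡ-≤; +-monoʳ-≤; +-monoʳ-<; +-cancelʳ-≤; module ≤-Reasoning)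
open import Data.Nat.Solver using (module +-*-Solver)
open +-*-Solver using (solve; _:+_; _:=_)
open import Data.List using (List; []; _∷_; _++_; replicate; length; map)
open import Data.List.Properties using (length-++; ++-assoc; ++-identityʳ; ∷-injective)
open import Data.Nat.ListAction using (sum)
open import Data.Nat.ListAction.Properties using (sum-++)
open import Data.List.Relation.Unary.All using ([]; _∷_)
open import Data.Product using (_×_; _,_; ∃-syntax; proj₁; proj₂)
open import Data.Sum using (_⊎_; inj₁; inj₂)
open import Data.Maybe using (just; nothing)
open import Data.Rational using (ℚ) renaming (_+_ to _+ℚ_; -_ to -ℚ_)
open import Data.Rational.Properties using (neg-distrib-+; neg-distribˡ-*)
open import Function using (_∘_)
open import Relation.Binary.PropositionalEquality using (_≡_; refl; sym; trans; cong; cong₂; subst; subst₂)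

trim-idem : ∀ xs → trim (trim xs) ≡ trim xs
trim-idem [] = refl
trim-idem (x ∷ xs) with trim xs | trim-idem xs
... | []     | _ with x
...   | zero  = refl
...   | suc _ = refl
trim-idem (x ∷ xs) | y ∷ ys | ih rewrite ih = refl

length-trim : ∀ xs → length (trim xs) ≤ length xs
length-trim [] = z≤n
length-trim (x ∷ xs) with trim xs | length-trim xs
... | []     | _ with x
...   | zero  = z≤n
...   | suc _ = s≤s z≤n
length-trim (x ∷ xs) | y ∷ ys | ih = s≤s ih

xs≡trim++zeros : ∀ xs → ∃[ j ] (xs ≡ trim xs ++ replicate j 0)
xs≡trim++zeros [] = 0 , refl
xs≡trim++zeros (x ∷ xs) with trim xs | xs≡trim++zeros xs
... | []     | j , eq with x
...   | zero  = suc j , cong (0 ∷_) eq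
...   | suc _ = j , cong (_ ∷_) eq
xs≡trim++zeros (x ∷ xs) | y ∷ ys | j , eq = j , cong (x ∷_) eq

trimmed-tail : ∀ x y ys → trim (x ∷ y ∷ ys) ≡ x ∷ y ∷ ys → trim (y ∷ ys) ≡ y ∷ ys
trimmed-tail x y ys eq with trim (y ∷ ys)
trimmed-tail zero    y ys () | []
trimmed-tail (suc x) y ys () | []
... | z ∷ zs with eq
... | refl = refl

trimmed-singleton⇒positive : ∀ x → trim (x ∷ []) ≡ x ∷ [] → 1 ≤ x
trimmed-singleton⇒positive (suc x) _ = s≤s z≤n

splitLastZero≡just : ∀ ν {γ a β} → splitLastZero ν ≡ just (γ , a , β) → ν ≡ γ ++ 0 ∷ a ∷ β
splitLastZero≡just (x ∷ xs) eq with splitLastZero xs in split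
splitLastZero≡just (x ∷ xs) refl | just _ = cong (x ∷_) (splitLastZero≡just xs split)
... | nothing with x | xs
splitLastZero≡just (_ ∷ _) refl | nothing | zero | _ ∷ _ = refl

splitLastZero-∷∷≡nothing : ∀ x y ys → splitLastZero (x ∷ y ∷ ys) ≡ nothing →
                           splitLastZero (y ∷ ys) ≡ nothing × 1 ≤ x
splitLastZero-∷∷≡nothing x y ys eq with splitLastZero (y ∷ ys)
splitLastZero-∷∷≡nothing x       y ys () | just _
... | nothing with x
splitLastZero-∷∷≡nothing x y ys ()   | nothing | zero
splitLastZero-∷∷≡nothing x y ys refl | nothing | suc _ = refl , s≤s z≤n

splitLastZero≡nothing⇒Standard : ∀ ν → trim ν ≡ ν → splitLastZero ν ≡ nothing → Standard ν
splitLastZero≡nothing⇒Standard [] _ _ = []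
splitLastZero≡nothing⇒Standard (x ∷ []) tr _ = trimmed-singleton⇒positive x tr ∷ []
splitLastZero≡nothing⇒Standard (x ∷ y ∷ ys) tr eq =
  proj₂ tail ∷ splitLastZero≡nothing⇒Standard (y ∷ ys) (trimmed-tail x y ys tr) (proj₁ tail)
  where
  tail : splitLastZero (y ∷ ys) ≡ nothing × 1 ≤ x
  tail = splitLastZero-∷∷≡nothing x y ys eq

AtLevel : ℕ → List ℕ → Set
AtLevel e π = e + length π ≤ sum π

HasPrefixAtLevel : ℕ → List ℕ → Set
HasPrefixAtLevel e α = ∃[ π ] ∃[ ρ ] ((π ++ ρ ≡ α) × AtLevel e π)

-- d(σ) − ℓ(σ) ≤ d(σ′) − ℓ(σ′), moved across so that no subtraction occurs.
infix 4 _≼_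
_≼_ : List ℕ → List ℕ → Set
σ ≼ σ′ = length σ′ + sum σ ≤ length σ + sum σ′

0≼[] : 0 ∷ [] ≼ []
0≼[] = z≤n

0∷a≼a∸1 : ∀ a → 0 ∷ a ∷ [] ≼ (a ∸ 1) ∷ []
0∷a≼a∸1 zero    = s≤s z≤n
0∷a≼a∸1 (suc a) = ≤-refl

a∸1≼0∷a : ∀ {a} → 0 < a → (a ∸ 1) ∷ [] ≼ 0 ∷ a ∷ []
a∸1≼0∷a (s≤s _) = ≤-refl

excess-exchange : ∀ {e lγ lσ lσ′ lτ sγ sσ sσ′ sτ} → lσ′ + sσ ≤ lσ + sσ′ →
                  e + (lγ + (lσ + lτ)) ≤ sγ + (sσ + sτ) → e + (lγ + (lσ′ + lτ)) ≤ sγ + (sσ′ + sτ)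
excess-exchange {e} {lγ} {lσ} {lσ′} {lτ} {sγ} {sσ} {sσ′} {sτ} excess lvl =
  +-cancelʳ-≤ sσ _ _ (begin
    e + (lγ + (lσ′ + lτ)) + sσ  ≡⟨ rearrange e lγ lσ′ lτ sσ ⟩
    (e + lγ + lτ) + (lσ′ + sσ)  ≤⟨ +-monoʳ-≤ (e + lγ + lτ) excess ⟩
    (e + lγ + lτ) + (lσ + sσ′)  ≡⟨ sym (rearrange e lγ lσ lτ sσ′) ⟩
    e + (lγ + (lσ + lτ)) + sσ′  ≤⟨ +-monoˡ-≤ sσ′ lvl ⟩
    sγ + (sσ + sτ) + sσ′        ≡⟨ swap sγ sσ sσ′ sτ ⟩
    sγ + (sσ′ + sτ) + sσ        ∎)
  where
  open ≤-Reasoning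
  rearrange : ∀ a b c d x → a + (b + (c + d)) + x ≡ (a + b + d) + (c + x)
  rearrange = solve 5 (λ a b c d x → a :+ (b :+ (c :+ d)) :+ x := (a :+ b :+ d) :+ (c :+ x)) refl
  swap : ∀ a b c d → a + (b + d) + c ≡ a + (c + d) + b
  swap = solve 4 (λ a b c d → a :+ (b :+ d) :+ c := a :+ (c :+ d) :+ b) refl

atLevel-replace : ∀ {e} γ σ σ′ τ → σ ≼ σ′ → AtLevel e (γ ++ σ ++ τ) → AtLevel e (γ ++ σ′ ++ τ)
atLevel-replace {e} γ σ σ′ τ excess lvl =
  subst₂ _≤_ (cong (e +_) (sym (length-++-++ σ′))) (sym (sum-++-++ σ′))
    (excess-exchange {e} {length γ} {length σ} {length σ′} {length τ} {sum γ} {sum σ} {sum σ′} {sum τ}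
       excess (subst₂ _≤_ (cong (e +_) (length-++-++ σ)) (sum-++-++ σ) lvl))
  where
  length-++-++ : ∀ ς → length (γ ++ ς ++ τ) ≡ length γ + (length ς + length τ)
  length-++-++ ς = trans (length-++ γ) (cong (length γ +_) (length-++ ς))
  sum-++-++ : ∀ ς → sum (γ ++ ς ++ τ) ≡ sum γ + (sum ς + sum τ)
  sum-++-++ ς = trans (sum-++ γ (ς ++ τ)) (cong (sum γ +_) (sum-++ ς τ))

prefixAtLevel-++ʳ : ∀ {e} γ u → HasPrefixAtLevel e γ → HasPrefixAtLevel e (γ ++ u)
prefixAtLevel-++ʳ _ u (π , τ , refl , lvl) = π , τ ++ u , sym (++-assoc π τ u) , lvl

prefixAtLevel-intro : ∀ {e} γ τ {ρ u} → τ ++ ρ ≡ u → AtLevel e (γ ++ τ) → HasPrefixAtLevel e (γ ++ u)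
prefixAtLevel-intro γ τ {ρ} refl lvl = γ ++ τ , ρ , ++-assoc γ τ ρ , lvl

++-split : ∀ {A : Set} (π : List A) {ρ} γ {u} → π ++ ρ ≡ γ ++ u →
           (∃[ τ ] (π ++ τ ≡ γ)) ⊎ (∃[ x ] ∃[ τ ] ((π ≡ γ ++ x ∷ τ) × (x ∷ τ ++ ρ ≡ u)))
++-split []      γ       _  = inj₁ (γ , refl)
++-split (p ∷ π) []      eq = inj₂ (p , π , refl , eq)
++-split (p ∷ π) (x ∷ γ) eq with ∷-injective eq
... | refl , eq′ with ++-split π γ eq′
...   | inj₁ (τ , refl)         = inj₁ (τ , refl)
...   | inj₂ (y , τ , refl , r) = inj₂ (y , τ , refl , r)

prefixAtLevel-transfer : ∀ {e} γ u u′ →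
  (∀ x τ {ρ} → x ∷ τ ++ ρ ≡ u → AtLevel e (γ ++ x ∷ τ) → HasPrefixAtLevel e (γ ++ u′)) →
  HasPrefixAtLevel e (γ ++ u) → HasPrefixAtLevel e (γ ++ u′)
prefixAtLevel-transfer γ u u′ step (π , ρ , eq , lvl) with ++-split π γ eq
... | inj₁ (τ , π++τ≡γ)          = prefixAtLevel-++ʳ γ u′ (π , τ , π++τ≡γ , lvl)
... | inj₂ (x , τ , refl , eq′) = step x τ eq′ lvl

prefixAtLevel-0∷u⇒u : ∀ {e} γ u → HasPrefixAtLevel e (γ ++ 0 ∷ u) → HasPrefixAtLevel e (γ ++ u)
prefixAtLevel-0∷u⇒u {e} γ u = prefixAtLevel-transfer γ (0 ∷ u) u dropZero
  where
  dropZero : ∀ x τ {ρ} → x ∷ τ ++ ρ ≡ 0 ∷ u → AtLevel e (γ ++ x ∷ τ) → HasPrefixAtLevel e (γ ++ u)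
  dropZero x τ eq lvl with ∷-injective eq
  ... | refl , τ++ρ≡u = prefixAtLevel-intro γ τ τ++ρ≡u (atLevel-replace γ (0 ∷ []) [] τ 0≼[] lvl)

prefixAtLevel-0∷a⇒a∸1 : ∀ {e} γ a u → HasPrefixAtLevel e (γ ++ 0 ∷ a ∷ u) →
                        HasPrefixAtLevel e (γ ++ (a ∸ 1) ∷ u)
prefixAtLevel-0∷a⇒a∸1 {e} γ a u = prefixAtLevel-transfer γ (0 ∷ a ∷ u) ((a ∸ 1) ∷ u) fuse
  where
  fuse : ∀ x τ {ρ} → x ∷ τ ++ ρ ≡ 0 ∷ a ∷ u → AtLevel e (γ ++ x ∷ τ) →
         HasPrefixAtLevel e (γ ++ (a ∸ 1) ∷ u)
  fuse _ [] refl lvl = prefixAtLevel-intro γ [] refl (atLevel-replace γ (0 ∷ []) [] [] 0≼[] lvl)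
  fuse x (y ∷ τ) eq lvl with ∷-injective eq
  ... | refl , eq′ with ∷-injective eq′
  ...   | refl , τ++ρ≡u = prefixAtLevel-intro γ ((a ∸ 1) ∷ τ) (cong ((a ∸ 1) ∷_) τ++ρ≡u)
                            (atLevel-replace γ (0 ∷ a ∷ []) ((a ∸ 1) ∷ []) τ (0∷a≼a∸1 a) lvl)

prefixAtLevel-a∸1⇒0∷a : ∀ {e} γ {a} u → 0 < a → HasPrefixAtLevel e (γ ++ (a ∸ 1) ∷ u) →
                        HasPrefixAtLevel e (γ ++ 0 ∷ a ∷ u)
prefixAtLevel-a∸1⇒0∷a {e} γ {a} u 0<a = prefixAtLevel-transfer γ ((a ∸ 1) ∷ u) (0 ∷ a ∷ u) unfuse
  where
  unfuse : ∀ x τ {ρ} → x ∷ τ ++ ρ ≡ (a ∸ 1) ∷ u → AtLevel e (γ ++ x ∷ τ) →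
           HasPrefixAtLevel e (γ ++ 0 ∷ a ∷ u)
  unfuse x τ eq lvl with ∷-injective eq
  ... | refl , τ++ρ≡u = prefixAtLevel-intro γ (0 ∷ a ∷ τ) (cong (λ v → 0 ∷ a ∷ v) τ++ρ≡u)
                          (atLevel-replace γ ((a ∸ 1) ∷ []) (0 ∷ a ∷ []) τ (a∸1≼0∷a 0<a) lvl)

prefixAtLevel-dropZeros : ∀ {e} α n → HasPrefixAtLevel e (α ++ replicate n 0) → HasPrefixAtLevel e α
prefixAtLevel-dropZeros α zero    = subst (HasPrefixAtLevel _) (++-identityʳ α)
prefixAtLevel-dropZeros α (suc n) = prefixAtLevel-dropZeros α n ∘ prefixAtLevel-0∷u⇒u α (replicate n 0)

prefixAtLevel-trim : ∀ {e} α → HasPrefixAtLevel e α → HasPrefixAtLevel e (trim α)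
prefixAtLevel-trim α with xs≡trim++zeros α
... | j , α≡trim++zeros = prefixAtLevel-dropZeros (trim α) j ∘ subst (HasPrefixAtLevel _) α≡trim++zeros

reachesLevel⇒prefixAtLevel : ∀ {e} α → ReachesLevel e α → HasPrefixAtLevel e α
reachesLevel⇒prefixAtLevel α (π , ρ , n , eq , lvl) = prefixAtLevel-dropZeros α n (π , ρ , eq , lvl)

prefixAtLevel⇒reachesLevel : ∀ {e} α → HasPrefixAtLevel e α → ReachesLevel e α
prefixAtLevel⇒reachesLevel α (π , ρ , eq , lvl) = π , ρ , 0 , trans eq (sym (++-identityʳ α)) , lvl

sumℚ-map-neg : ∀ {A : Set} {f g : A → ℚ} xs → (∀ x → f x ≡ -ℚ g x) →
               sumℚ (map f xs) ≡ -ℚ sumℚ (map g xs)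
sumℚ-map-neg []       _      = refl
sumℚ-map-neg {g = g} (x ∷ xs) f≡-g =
  trans (cong₂ _+ℚ_ (f≡-g x) (sumℚ-map-neg xs f≡-g)) (sym (neg-distrib-+ (g x) _))

InJ-⊖-⊛ : ∀ {e f g} r → InJ e f → InJ e g → InJ e (f ⊖ r ⊛ g)
InJ-⊖-⊛ {e} {f} {g} r f∈J g∈J = resp neg-⊛ (add f∈J (mul (λ m → -ℚ r m) g∈J))
  where
  neg-⊛ : f ⊕ (λ m → -ℚ r m) ⊛ g ≈ f ⊖ r ⊛ g
  neg-⊛ m = cong (f (trim m) +ℚ_) (sumℚ-map-neg (splits (trim m))
              λ { (p , q) → sym (neg-distribˡ-* (r (trim p)) (g (trim q))) })

length-fuse< : ∀ γ c a β → length (γ ++ c ∷ β) < length (γ ++ 0 ∷ a ∷ β)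
length-fuse< γ c a β rewrite length-++ γ {c ∷ β} | length-++ γ {0 ∷ a ∷ β} =
  +-monoʳ-< (length γ) (n<1+n _)

Gfuel∈J : ∀ {e} fuel ν → trim ν ≡ ν → length ν ≤ fuel → HasPrefixAtLevel e ν → InJ e (Gfuel fuel ν)
Gfuel∈J zero    []      _ _  lvl = gen [] ([] , lvl)
Gfuel∈J zero    (_ ∷ _) _ () _
Gfuel∈J {e} (suc n) ν trimmed len lvl with splitLastZero ν in split
... | nothing = gen ν (splitLastZero≡nothing⇒Standard ν trimmed split , lvl)
... | just (γ , a , β) with splitLastZero≡just ν split
...   | refl = InJ-⊖-⊛ (var (length γ)) (child a (prefixAtLevel-0∷u⇒u γ (a ∷ β) lvl))
                                        (child (a ∸ 1) (prefixAtLevel-0∷a⇒a∸1 γ a β lvl))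
  where
  child : ∀ c → HasPrefixAtLevel e (γ ++ c ∷ β) → InJ e (Gfuel n (trim (γ ++ c ∷ β)))
  child c lvl′ = Gfuel∈J n (trim (γ ++ c ∷ β)) (trim-idem (γ ++ c ∷ β))
                   (≤-trans (length-trim (γ ++ c ∷ β)) (s≤s⁻¹ (≤-trans (length-fuse< γ c a β) len)))
                   (prefixAtLevel-trim (γ ++ c ∷ β) lvl′)

G∈J : ∀ {e} α → ReachesLevel e α → InJ e (G α)
G∈J α reaches = Gfuel∈J (length (trim α)) (trim α) (trim-idem α) ≤-refl
                  (prefixAtLevel-trim α (reachesLevel⇒prefixAtLevel α reaches))

lemma3p1 : (∀ (e : ℕ) (α : List ℕ) → ReachesLevel e α → InJ e (G α))
           × (∀ (e : ℕ) (γ : List ℕ) (a : ℕ) (β : List ℕ) → 0 < a → Standard β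
                → ReachesLevel e (γ ++ (a ∸ 1) ∷ β) → ReachesLevel e (γ ++ 0 ∷ a ∷ β))
lemma3p1 = (λ _ → G∈J)
         , λ _ γ a β 0<a _ → prefixAtLevel⇒reachesLevel (γ ++ 0 ∷ a ∷ β)
                            ∘ prefixAtLevel-a∸1⇒0∷a γ β 0<a
                            ∘ reachesLevel⇒prefixAtLevel (γ ++ (a ∸ 1) ∷ β)
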